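{- Let $Q$ be an incompatible set of quartets over a set of $n$ labels such that every proper subset of $Q$ is compatible, and let $r=n-2$. Then there exists a set $C$ of $|Q|$ $r$-state characters such that $C$ is incompatible but every proper subset of $C$ is compatible.
   Context: A quartet is a binary unrooted phylogenetic tree with four leaves; $ab|cd$ denotes the quartet on $\{a,b,c,d\}$ in which the path between $a$ and $b$ is disjoint from the path between $c$ and $d$. A tree $T$ displays a tree $T'$ if $T'$ is obtained from the restriction $T|\mathcal{L}(T')$ (minimal subtree spanning the leaves labeled by $\mathcal{L}(T')$, with degree-two vertices suppressed) by contracting edges. A set of quartets is compatible if some unrooted phylogenetic tree (tree with no degree-two vertex, leaves bijectively labeled) displays all of them, and incompatible otherwise; "over $n$ labels" means the union of their label sets has $n$ elements. A character on a label set $L$ is a partition of $L$ into parts called states; it is $r$-state if it has at most $r$ parts. For a tree $T$ with leaf label set $L$, a character $\chi$ is convex on $T$ if for distinct states $i,j$ the minimal subtrees of $T$ spanning the leaves with labels in $i$ and in $j$ are vertex-disjoint. A set of characters on $L$ is compatible if there is an unrooted phylogenetic tree with leaf label set $L$ on which all of them are convex, and incompatible otherwise. -}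

module Defs where

open import Data.Nat using (ℕ; _≤_)
open import Data.Bool using (Bool; true; false)
open import Data.Fin using (Fin)
open import Data.Fin.Subset using (Subset; _∈_; _∉_; ∣_∣)
open import Data.Vec using (tabulate)
open import Data.List using (List; []; _∷_)
open import Data.List.Relation.Unary.Unique.Propositional using (Unique)
import Data.List.Membership.Propositional as LM
open import Data.Product using (Σ; ∃; ∃-syntax; _×_; _,_)
open import Data.Sum using (_⊎_)
open import Data.Empty using (⊥)
open import Relation.Nullary using (¬_)
open import Relation.Binary.PropositionalEquality using (_≡_; _≢_)
open import Function.Bundles using (_⇔_)

data Walk {m : ℕ} (adj : Fin m → Fin m → Bool) : Fin m → Fin m → Set where
  here : ∀ {a} → Walk adj a a
  step : ∀ {a b c} → adj a b ≡ true → Walk adj b c → Walk adj a c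

verts : ∀ {m} {adj : Fin m → Fin m → Bool} {a b} → Walk adj a b → List (Fin m)
verts {a = a} here = a ∷ []
verts {a = a} (step _ w) = a ∷ verts w

IsPath : ∀ {m} {adj : Fin m → Fin m → Bool} {a b} → Walk adj a b → Set
IsPath w = Unique (verts w)

degree : ∀ {m} → (Fin m → Fin m → Bool) → Fin m → ℕ
degree adj v = ∣ tabulate (adj v) ∣

record PhyloTree (n : ℕ) : Set where
  field
    m          : ℕ
    adj        : Fin m → Fin m → Bool
    adj-sym    : ∀ u v → adj u v ≡ adj v u
    adj-irrefl : ∀ v → adj v v ≡ false
    connected  : ∀ u v → Walk adj u v
    uniquePath : ∀ u v (p q : Walk adj u v) → IsPath p → IsPath q → verts p ≡ verts q
    leaf       : Fin n → Fin m
    leaf-inj   : ∀ x y → leaf x ≡ leaf y → x ≡ y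
    leaf-deg   : ∀ x → degree adj (leaf x) ≤ 1
    leaf-onto  : ∀ v → degree adj v ≤ 1 → ∃[ x ] leaf x ≡ v
    no-deg2    : ∀ v → ¬ (degree adj v ≡ 2)

module _ {n : ℕ} (T : PhyloTree n) where
  open PhyloTree T

  OnPath : Fin m → Fin n → Fin n → Set
  OnPath v x y = Σ (Walk adj (leaf x) (leaf y)) λ p → IsPath p × LM._∈_ v (verts p)

  -- v lies in the minimal subtree of T spanning the leaves whose labels
  -- satisfy S (the union of the paths between such leaves)
  InSpan : (Fin n → Set) → Fin m → Set
  InSpan S v = ∃[ x ] ∃[ y ] (S x × S y × OnPath v x y)

record Quartet (n : ℕ) : Set where
  constructor _∣_∥_∣_
  field
    a b c d : Fin n
    ab : a ≢ b
    ac : a ≢ c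
    ad : a ≢ d
    bc : b ≢ c
    bd : b ≢ d
    cd : c ≢ d

open Quartet public

SamePair : ∀ {n} → Fin n → Fin n → Fin n → Fin n → Set
SamePair x y x' y' = (x ≡ x' × y ≡ y') ⊎ (x ≡ y' × y ≡ x')

SameQuartet : ∀ {n} → Quartet n → Quartet n → Set
SameQuartet q q' =
  (SamePair (a q) (b q) (a q') (b q') × SamePair (c q) (d q) (c q') (d q'))
  ⊎ (SamePair (a q) (b q) (c q') (d q') × SamePair (c q) (d q) (a q') (b q'))

InQuartet : ∀ {n} → Fin n → Quartet n → Set
InQuartet x q = x ≡ a q ⊎ x ≡ b q ⊎ x ≡ c q ⊎ x ≡ d q

Displays : ∀ {n} → PhyloTree n → Quartet n → Set
Displays T q = ∀ v → OnPath T v (a q) (b q) → OnPath T v (c q) (d q) → ⊥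

QuartetsCompatible : ∀ {n k} → (Fin k → Quartet n) → Subset k → Set
QuartetsCompatible {n} q S = ∃[ T ] (∀ i → i ∈ S → Displays {n} T (q i))

-- Characters: a character on Fin n with at most r states is given by a
-- state assignment Fin n → Fin r; its states (parts) are the nonempty fibres.

Character : ℕ → ℕ → Set
Character n r = Fin n → Fin r

SamePartition : ∀ {n r} → Character n r → Character n r → Set
SamePartition χ χ' = ∀ x y → (χ x ≡ χ y) ⇔ (χ' x ≡ χ' y)

Convex : ∀ {n r} → PhyloTree n → Character n r → Set
Convex T χ = ∀ i j → i ≢ j → ∀ v →
  InSpan T (λ x → χ x ≡ i) v → InSpan T (λ x → χ x ≡ j) v → ⊥

CharactersCompatible : ∀ {n r k} → (Fin k → Character n r) → Subset k → Set
CharactersCompatible {n} χ S = ∃[ T ] (∀ i → i ∈ S → Convex {n} T (χ i))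

Proper : ∀ {k} → Subset k → Set
Proper S = ∃[ i ] i ∉ S

-- A quartet ab|cd determines the (n−2)-state character whose states are {a,b}, {c,d} and
-- the remaining singletons. A tree displays ab|cd exactly when this character is convex on
-- it: the spanning subtrees of the singleton states are single leaves, which lie on no path
-- between two other leaves, so the only possible overlap is between the a–b and c–d paths.
-- Distinct quartets give distinct partitions, and compatibility of every subfamily transfers
-- in both directions, so minimal incompatibility of Q passes to the characters χ_q.
module Submission where

open import Defs
open import Data.Nat using (ℕ; _∸_; zero; suc; _≤_; _<_)
open import Data.Nat.Properties using (<⇒≱)
open import Data.Bool using (Bool; true)
open import Data.Fin using (Fin; zero; punchOut; _≟_)
open import Data.Fin.Properties using (punchOut-injective; punchOut-cong)
open import Data.Fin.Subset using (⊤; ⁅_⁆; _⊂_) renaming (_∈_ to _∈ₛ_)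
open import Data.Fin.Subset.Properties using (p⊂q⇒∣p∣<∣q∣; ∣⁅x⁆∣≡1; x∈⁅y⁆⇒x≡y)
open import Data.Vec using (tabulate)
open import Data.Vec.Properties using (lookup∘tabulate; lookup⇒[]=)
open import Data.List using (List; _∷_; _++_; [_]; reverse)
open import Data.List.Properties using (unfold-reverse)
open import Data.List.Relation.Unary.Any using (here; there)
open import Data.List.Relation.Unary.All as All using (All)
open import Data.List.Relation.Unary.AllPairs using (_∷_)
open import Data.List.Relation.Unary.Unique.Propositional using (Unique)
open import Data.List.Membership.Propositional using (_∈_)
open import Data.List.Relation.Binary.Permutation.Propositional using (↭-sym; ↭⇒↭ₛ)
open import Data.List.Relation.Binary.Permutation.Propositional.Properties using (↭-reverse; ∈-resp-↭)
import Data.List.Relation.Binary.Permutation.Setoid.Properties as Permutationₛ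
open import Data.Product using (Σ; ∃; ∃₂; ∃-syntax; _×_; _,_; proj₁; proj₂)
open import Data.Sum using (_⊎_; inj₁; inj₂)
open import Data.Empty using (⊥; ⊥-elim)
open import Function using (_∘_)
open import Function.Bundles using (_⇔_; mk⇔; Equivalence)
open import Relation.Nullary using (¬_; yes; no)
open import Relation.Binary.PropositionalEquality
  using (_≡_; _≢_; refl; sym; trans; cong; subst; setoid; module ≡-Reasoning)

open Equivalence using (to; from)

two-neighbours⇒2≤degree : ∀ {m} (adj : Fin m → Fin m → Bool) {v p q} → p ≢ q →
                          adj v p ≡ true → adj v q ≡ true → 2 ≤ degree adj v
two-neighbours⇒2≤degree adj {v} {p} {q} p≢q vp vq =
  subst (_< degree adj v) (∣⁅x⁆∣≡1 p) (p⊂q⇒∣p∣<∣q∣ ⁅p⁆⊂N)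
  where
    N = tabulate (adj v)
    ∈N : ∀ {x} → adj v x ≡ true → x ∈ₛ N
    ∈N {x} vx = lookup⇒[]= x N (trans (lookup∘tabulate (adj v) x) vx)
    ⁅p⁆⊂N : ⁅ p ⁆ ⊂ N
    ⁅p⁆⊂N = (λ x∈⁅p⁆ → subst (_∈ₛ N) (sym (x∈⁅y⁆⇒x≡y p x∈⁅p⁆)) (∈N vp))
          , q , ∈N vq , λ q∈⁅p⁆ → p≢q (sym (x∈⁅y⁆⇒x≡y p q∈⁅p⁆))

unique-reverse : ∀ {A : Set} (xs : List A) → Unique xs → Unique (reverse xs)
unique-reverse {A} xs = Permutationₛ.Unique-resp-↭ (setoid A) (↭⇒↭ₛ (↭-sym (↭-reverse xs)))

OneOf : ∀ {n} → Fin n → Fin n → Fin n → Set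
OneOf x p q = x ≡ p ⊎ x ≡ q

module Paths {n : ℕ} (T : PhyloTree n) where
  open PhyloTree T

  HasTwoNeighbours : Fin m → Set
  HasTwoNeighbours v = ∃₂ λ p q → p ≢ q × adj v p ≡ true × adj v q ≡ true

  head∈verts : ∀ {s t} (w : Walk adj s t) → s ∈ verts w
  head∈verts here       = here refl
  head∈verts (step _ _) = here refl

  last∈verts : ∀ {s t} (w : Walk adj s t) → t ∈ verts w
  last∈verts here       = here refl
  last∈verts (step _ w) = there (last∈verts w)

  second-vertex : ∀ {s b t} → adj s b ≡ true → (w : Walk adj b t) → All (s ≢_) (verts w) →
                  b ≡ t ⊎ HasTwoNeighbours b
  second-vertex sb here        _   = inj₁ refl
  second-vertex sb (step bc w) s∉w =
    inj₂ (_ , _ , All.lookup s∉w (there (head∈verts w)) , trans (adj-sym _ _) sb , bc)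

  ∈path⇒endpoint⊎inner : ∀ {s t v} (w : Walk adj s t) → IsPath w → v ∈ verts w →
                         v ≡ s ⊎ v ≡ t ⊎ HasTwoNeighbours v
  ∈path⇒endpoint⊎inner here        _           (here v≡s) = inj₁ v≡s
  ∈path⇒endpoint⊎inner (step _ _)  _           (here v≡s) = inj₁ v≡s
  ∈path⇒endpoint⊎inner (step sb w) (s∉w ∷ pw) (there v∈w) with ∈path⇒endpoint⊎inner w pw v∈w
  ... | inj₁ refl = inj₂ (second-vertex sb w s∉w)
  ... | inj₂ r    = inj₂ r

  ∈closedPath⇒≡ : ∀ {s v} (w : Walk adj s s) → IsPath w → v ∈ verts w → v ≡ s
  ∈closedPath⇒≡ here       _         (here v≡s) = v≡s
  ∈closedPath⇒≡ (step _ _) _         (here v≡s) = v≡s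
  ∈closedPath⇒≡ (step _ w) (s∉w ∷ _) (there _)  = ⊥-elim (All.lookup s∉w (last∈verts w) refl)

  snoc : ∀ {s t u} → Walk adj s t → adj t u ≡ true → Walk adj s u
  snoc here       tu = step tu here
  snoc (step e w) tu = step e (snoc w tu)

  verts-snoc : ∀ {s t u} (w : Walk adj s t) (tu : adj t u ≡ true) → verts (snoc w tu) ≡ verts w ++ [ u ]
  verts-snoc here       tu = refl
  verts-snoc (step e w) tu = cong (_ ∷_) (verts-snoc w tu)

  reverseWalk : ∀ {s t} → Walk adj s t → Walk adj t s
  reverseWalk here       = here
  reverseWalk (step e w) = snoc (reverseWalk w) (trans (adj-sym _ _) e)

  verts-reverseWalk : ∀ {s t} (w : Walk adj s t) → verts (reverseWalk w) ≡ reverse (verts w)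
  verts-reverseWalk here = refl
  verts-reverseWalk {s} (step e w) = begin
    verts (snoc (reverseWalk w) _) ≡⟨ verts-snoc (reverseWalk w) _ ⟩
    verts (reverseWalk w) ++ [ s ] ≡⟨ cong (_++ [ s ]) (verts-reverseWalk w) ⟩
    reverse (verts w) ++ [ s ]     ≡⟨ sym (unfold-reverse s (verts w)) ⟩
    reverse (s ∷ verts w)          ∎
    where open ≡-Reasoning

  onPath-sym : ∀ {v x y} → OnPath T v x y → OnPath T v y x
  onPath-sym (w , pw , v∈w) =
    reverseWalk w
    , subst Unique (sym (verts-reverseWalk w)) (unique-reverse (verts w) pw)
    , subst (_ ∈_) (sym (verts-reverseWalk w)) (∈-resp-↭ (↭-sym (↭-reverse (verts w))) v∈w)

  onPath-refl⇒leaf : ∀ {v x} → OnPath T v x x → v ≡ leaf x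
  onPath-refl⇒leaf (w , pw , v∈w) = ∈closedPath⇒≡ w pw v∈w

  leaf-onPath⇒endpoint : ∀ {z x y} → OnPath T (leaf z) x y → OneOf z x y
  leaf-onPath⇒endpoint {z} (w , pw , z∈w) with ∈path⇒endpoint⊎inner w pw z∈w
  ... | inj₁ z≡x                         = inj₁ (leaf-inj _ _ z≡x)
  ... | inj₂ (inj₁ z≡y)                  = inj₂ (leaf-inj _ _ z≡y)
  ... | inj₂ (inj₂ (p , q , p≢q , zp , zq)) =
    ⊥-elim (<⇒≱ (two-neighbours⇒2≤degree adj p≢q zp zq) (leaf-deg z))

  onPath-within : ∀ {v x y p q} → OneOf x p q → OneOf y p q → OnPath T v x y →
                  v ≡ leaf x ⊎ OnPath T v p q
  onPath-within (inj₁ refl) (inj₁ refl) op = inj₁ (onPath-refl⇒leaf op)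
  onPath-within (inj₁ refl) (inj₂ refl) op = inj₂ op
  onPath-within (inj₂ refl) (inj₁ refl) op = inj₂ (onPath-sym op)
  onPath-within (inj₂ refl) (inj₂ refl) op = inj₁ (onPath-refl⇒leaf op)

Glued : ∀ {n} → Fin n → Fin n → Fin n → Fin n → Set
Glued i j x y = x ≡ y ⊎ (OneOf x i j × OneOf y i j)

-- The surjection Fin (suc n) → Fin n that identifies i with j and is injective elsewhere.
identify : ∀ {n} (i j : Fin (suc n)) → i ≢ j → Fin (suc n) → Fin n
identify i j i≢j x with x ≟ i
... | yes _  = punchOut i≢j
... | no x≢i = punchOut (x≢i ∘ sym)

module _ {n} (i j : Fin (suc n)) (i≢j : i ≢ j) where

  identify-oneOf : ∀ {x} → OneOf x i j → identify i j i≢j x ≡ punchOut i≢j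
  identify-oneOf {x} (inj₁ refl) with x ≟ x
  ... | yes _  = refl
  ... | no x≢x = ⊥-elim (x≢x refl)
  identify-oneOf {x} (inj₂ refl) with x ≟ i
  ... | yes _ = refl
  ... | no _  = punchOut-cong i refl

  identify-glued : ∀ {x y} → Glued i j x y → identify i j i≢j x ≡ identify i j i≢j y
  identify-glued (inj₁ refl)      = refl
  identify-glued (inj₂ (xij , yij)) = trans (identify-oneOf xij) (sym (identify-oneOf yij))

  identify-kernel : ∀ {x y} → identify i j i≢j x ≡ identify i j i≢j y → Glued i j x y
  identify-kernel {x} {y} eq with x ≟ i | y ≟ i
  ... | yes x≡i | yes y≡i = inj₁ (trans x≡i (sym y≡i))
  ... | yes x≡i | no y≢i  = inj₂ (inj₁ x≡i , inj₂ (sym (punchOut-injective i≢j _ eq)))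
  ... | no x≢i  | yes y≡i = inj₂ (inj₂ (punchOut-injective _ i≢j eq) , inj₁ y≡i)
  ... | no x≢i  | no y≢i  = inj₁ (punchOut-injective (x≢i ∘ sym) (y≢i ∘ sym) eq)

  identify-injectiveAt : ∀ {x y} → ¬ OneOf x i j → identify i j i≢j y ≡ identify i j i≢j x → y ≡ x
  identify-injectiveAt x∉ij eq with identify-kernel eq
  ... | inj₁ y≡x        = y≡x
  ... | inj₂ (_ , x∈ij) = ⊥-elim (x∉ij x∈ij)

SameSide : ∀ {n} → Quartet n → Fin n → Fin n → Set
SameSide q x y = x ≡ y
               ⊎ (OneOf x (a q) (b q) × OneOf y (a q) (b q))
               ⊎ (OneOf x (c q) (d q) × OneOf y (c q) (d q))

record IsQuartetCharacter {n r} (q : Quartet n) (χ : Character n r) : Set where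
  constructor isQuartetCharacter
  field
    ≡⇔sameSide : ∀ x y → χ x ≡ χ y ⇔ SameSide q x y

open IsQuartetCharacter

c∉ab : ∀ {n} (q : Quartet n) → ¬ OneOf (c q) (a q) (b q)
c∉ab q (inj₁ c≡a) = ac q (sym c≡a)
c∉ab q (inj₂ c≡b) = bc q (sym c≡b)

d∉ab : ∀ {n} (q : Quartet n) → ¬ OneOf (d q) (a q) (b q)
d∉ab q (inj₁ d≡a) = ad q (sym d≡a)
d∉ab q (inj₂ d≡b) = bd q (sym d≡b)

glueCherries : ∀ {m} (q : Quartet (suc (suc m))) → Σ (Character (suc (suc m)) m) (IsQuartetCharacter q)
glueCherries q = g₂ ∘ g₁ , isQuartetCharacter λ x y → mk⇔ (kernel x y) (glued x y)
  where
    g₁ = identify (a q) (b q) (ab q)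
    g₁c≢g₁d : g₁ (c q) ≢ g₁ (d q)
    g₁c≢g₁d eq = cd q (identify-injectiveAt (a q) (b q) (ab q) (d∉ab q) eq)
    g₂ = identify (g₁ (c q)) (g₁ (d q)) g₁c≢g₁d

    oneOf-g₁⁻ : ∀ x → OneOf (g₁ x) (g₁ (c q)) (g₁ (d q)) → OneOf x (c q) (d q)
    oneOf-g₁⁻ x (inj₁ eq) = inj₁ (identify-injectiveAt (a q) (b q) (ab q) (c∉ab q) eq)
    oneOf-g₁⁻ x (inj₂ eq) = inj₂ (identify-injectiveAt (a q) (b q) (ab q) (d∉ab q) eq)

    kernel : ∀ x y → g₂ (g₁ x) ≡ g₂ (g₁ y) → SameSide q x y
    kernel x y eq with identify-kernel _ _ g₁c≢g₁d eq
    ... | inj₂ (xcd , ycd) = inj₂ (inj₂ (oneOf-g₁⁻ x xcd , oneOf-g₁⁻ y ycd))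
    ... | inj₁ eq₁ with identify-kernel (a q) (b q) (ab q) eq₁
    ...   | inj₁ x≡y         = inj₁ x≡y
    ...   | inj₂ (xab , yab) = inj₂ (inj₁ (xab , yab))

    glued : ∀ x y → SameSide q x y → g₂ (g₁ x) ≡ g₂ (g₁ y)
    glued x y (inj₁ refl)                = refl
    glued x y (inj₂ (inj₁ xy∈ab))        = cong g₂ (identify-glued (a q) (b q) (ab q) (inj₂ xy∈ab))
    glued x y (inj₂ (inj₂ (xcd , ycd))) =
      identify-glued _ _ g₁c≢g₁d (inj₂ (oneOf-g₁ xcd , oneOf-g₁ ycd))
      where
        oneOf-g₁ : ∀ {z} → OneOf z (c q) (d q) → OneOf (g₁ z) (g₁ (c q)) (g₁ (d q))
        oneOf-g₁ (inj₁ refl) = inj₁ refl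
        oneOf-g₁ (inj₂ refl) = inj₂ refl

quartetCharacter : ∀ {n} (q : Quartet n) → Σ (Character n (n ∸ 2)) (IsQuartetCharacter q)
quartetCharacter {zero} q with a q
... | ()
quartetCharacter {suc zero} q with a q | b q | ab q
... | zero | zero | a≢b = ⊥-elim (a≢b refl)
quartetCharacter {suc (suc m)} q = glueCherries q

oneOf⇒samePair : ∀ {n} {x y p q : Fin n} → x ≢ y → OneOf x p q → OneOf y p q → SamePair x y p q
oneOf⇒samePair x≢y (inj₁ x≡p) (inj₁ y≡p) = ⊥-elim (x≢y (trans x≡p (sym y≡p)))
oneOf⇒samePair x≢y (inj₁ x≡p) (inj₂ y≡q) = inj₁ (x≡p , y≡q)
oneOf⇒samePair x≢y (inj₂ x≡q) (inj₁ y≡p) = inj₂ (x≡q , y≡p)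
oneOf⇒samePair x≢y (inj₂ x≡q) (inj₂ y≡q) = ⊥-elim (x≢y (trans x≡q (sym y≡q)))

samePair-shared : ∀ {n} {x y z w p q : Fin n} → SamePair x y p q → SamePair z w p q → OneOf z x y
samePair-shared (inj₁ (x≡p , _)) (inj₁ (z≡p , _)) = inj₁ (trans z≡p (sym x≡p))
samePair-shared (inj₁ (_ , y≡q)) (inj₂ (z≡q , _)) = inj₂ (trans z≡q (sym y≡q))
samePair-shared (inj₂ (_ , y≡p)) (inj₁ (z≡p , _)) = inj₂ (trans z≡p (sym y≡p))
samePair-shared (inj₂ (x≡q , _)) (inj₂ (z≡q , _)) = inj₁ (trans z≡q (sym x≡q))

sameSide⇒samePair : ∀ {n} (q : Quartet n) {x y} → x ≢ y → SameSide q x y →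
                    SamePair x y (a q) (b q) ⊎ SamePair x y (c q) (d q)
sameSide⇒samePair q x≢y (inj₁ x≡y)                = ⊥-elim (x≢y x≡y)
sameSide⇒samePair q x≢y (inj₂ (inj₁ (xab , yab))) = inj₁ (oneOf⇒samePair x≢y xab yab)
sameSide⇒samePair q x≢y (inj₂ (inj₂ (xcd , ycd))) = inj₂ (oneOf⇒samePair x≢y xcd ycd)

-- Both cherries of q land in the same cherry of q' only if c q is a or b.
sameSide⊆⇒sameQuartet : ∀ {n} (q q' : Quartet n) → (∀ x y → SameSide q x y → SameSide q' x y) →
                        SameQuartet q q'
sameSide⊆⇒sameQuartet q q' ⊆
  with sameSide⇒samePair q' (ab q) (⊆ (a q) (b q) (inj₂ (inj₁ (inj₁ refl , inj₂ refl))))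
     | sameSide⇒samePair q' (cd q) (⊆ (c q) (d q) (inj₂ (inj₂ (inj₁ refl , inj₂ refl))))
... | inj₁ ab~a'b' | inj₂ cd~c'd' = inj₁ (ab~a'b' , cd~c'd')
... | inj₂ ab~c'd' | inj₁ cd~a'b' = inj₂ (ab~c'd' , cd~a'b')
... | inj₁ ab~a'b' | inj₁ cd~a'b' = ⊥-elim (c∉ab q (samePair-shared ab~a'b' cd~a'b'))
... | inj₂ ab~c'd' | inj₂ cd~c'd' = ⊥-elim (c∉ab q (samePair-shared ab~c'd' cd~c'd'))

samePartition⇒sameQuartet : ∀ {n r} {q q' : Quartet n} {χ χ' : Character n r} →
                            IsQuartetCharacter q χ → IsQuartetCharacter q' χ' →
                            SamePartition χ χ' → SameQuartet q q'
samePartition⇒sameQuartet {q = q} {q'} isχ isχ' χ~χ' =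
  sameSide⊆⇒sameQuartet q q' λ x y →
    to (≡⇔sameSide isχ' x y) ∘ to (χ~χ' x y) ∘ from (≡⇔sameSide isχ x y)

module _ {n r} (T : PhyloTree n) {q : Quartet n} {χ : Character n r} (isχ : IsQuartetCharacter q χ) where
  open PhyloTree T
  open Paths T

  χ-ab : ∀ {x} → OneOf x (a q) (b q) → χ (a q) ≡ χ x
  χ-ab xab = from (≡⇔sameSide isχ _ _) (inj₂ (inj₁ (inj₁ refl , xab)))

  χ-cd : ∀ {x} → OneOf x (c q) (d q) → χ (c q) ≡ χ x
  χ-cd xcd = from (≡⇔sameSide isχ _ _) (inj₂ (inj₂ (inj₁ refl , xcd)))

  SpanCase : Fin m → Fin r → Set
  SpanCase v s = (∃[ z ] χ z ≡ s × v ≡ leaf z)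
               ⊎ (χ (a q) ≡ s × OnPath T v (a q) (b q))
               ⊎ (χ (c q) ≡ s × OnPath T v (c q) (d q))

  spanCase : ∀ {v s} → InSpan T (λ x → χ x ≡ s) v → SpanCase v s
  spanCase (x , y , χx≡s , χy≡s , op) with to (≡⇔sameSide isχ x y) (trans χx≡s (sym χy≡s))
  ... | inj₁ refl = inj₁ (x , χx≡s , onPath-refl⇒leaf op)
  ... | inj₂ (inj₁ (xab , yab)) with onPath-within xab yab op
  ...   | inj₁ v≡x  = inj₁ (x , χx≡s , v≡x)
  ...   | inj₂ opab = inj₂ (inj₁ (trans (χ-ab xab) χx≡s , opab))
  spanCase (x , y , χx≡s , χy≡s , op) | inj₂ (inj₂ (xcd , ycd)) with onPath-within xcd ycd op
  ...   | inj₁ v≡x  = inj₁ (x , χx≡s , v≡x)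
  ...   | inj₂ opcd = inj₂ (inj₂ (trans (χ-cd xcd) χx≡s , opcd))

  leaf-spanCase⇒state : ∀ {z s} → SpanCase (leaf z) s → χ z ≡ s
  leaf-spanCase⇒state (inj₁ (z' , χz'≡s , z~z')) = trans (cong χ (leaf-inj _ _ z~z')) χz'≡s
  leaf-spanCase⇒state (inj₂ (inj₁ (χa≡s , op))) =
    trans (sym (χ-ab (leaf-onPath⇒endpoint op))) χa≡s
  leaf-spanCase⇒state (inj₂ (inj₂ (χc≡s , op))) =
    trans (sym (χ-cd (leaf-onPath⇒endpoint op))) χc≡s

  displays⇒convex : Displays T q → Convex T χ
  displays⇒convex displays i j i≢j v vi vj = separate (spanCase vi) (spanCase vj)
    where
      separate : SpanCase v i → SpanCase v j → ⊥
      separate (inj₁ (z , χz≡i , refl)) vj = i≢j (trans (sym χz≡i) (leaf-spanCase⇒state vj))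
      separate vi (inj₁ (z , χz≡j , refl)) = i≢j (trans (sym (leaf-spanCase⇒state vi)) χz≡j)
      separate (inj₂ (inj₁ (χa≡i , _)))  (inj₂ (inj₁ (χa≡j , _)))  = i≢j (trans (sym χa≡i) χa≡j)
      separate (inj₂ (inj₂ (χc≡i , _)))  (inj₂ (inj₂ (χc≡j , _)))  = i≢j (trans (sym χc≡i) χc≡j)
      separate (inj₂ (inj₁ (_ , opab)))  (inj₂ (inj₂ (_ , opcd)))  = displays v opab opcd
      separate (inj₂ (inj₂ (_ , opcd)))  (inj₂ (inj₁ (_ , opab)))  = displays v opab opcd

  convex⇒displays : Convex T χ → Displays T q
  convex⇒displays convex v opab opcd =
    convex (χ (a q)) (χ (c q)) χa≢χc v
      (a q , b q , refl , sym (χ-ab (inj₂ refl)) , opab)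
      (c q , d q , refl , sym (χ-cd (inj₂ refl)) , opcd)
    where
      χa≢χc : χ (a q) ≢ χ (c q)
      χa≢χc eq with to (≡⇔sameSide isχ _ _) eq
      ... | inj₁ a≡c                   = ac q a≡c
      ... | inj₂ (inj₁ (_ , cab))      = c∉ab q cab
      ... | inj₂ (inj₂ (inj₁ a≡c , _)) = ac q a≡c
      ... | inj₂ (inj₂ (inj₂ a≡d , _)) = ad q a≡d

  displays⇔convex : Displays T q ⇔ Convex T χ
  displays⇔convex = mk⇔ displays⇒convex convex⇒displays

theorem3 : (n k : ℕ) (Q : Fin k → Quartet n)
    → (∀ i j → SameQuartet (Q i) (Q j) → i ≡ j)
    → (∀ x → ∃[ i ] InQuartet x (Q i))
    → ¬ QuartetsCompatible Q ⊤
    → (∀ S → Proper S → QuartetsCompatible Q S)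
    → ∃ λ (C : Fin k → Character n (n ∸ 2)) → (∀ i j → SamePartition (C i) (C j) → i ≡ j)
        × ¬ CharactersCompatible C ⊤
        × (∀ S → Proper S → CharactersCompatible C S)
theorem3 n k Q Q-distinct _ Q-incompatible Q-minimal =
  C , C-distinct , C-incompatible , C-minimal
  where
    C : Fin k → Character n (n ∸ 2)
    C i = proj₁ (quartetCharacter (Q i))

    isC : ∀ i → IsQuartetCharacter (Q i) (C i)
    isC i = proj₂ (quartetCharacter (Q i))

    C-distinct : ∀ i j → SamePartition (C i) (C j) → i ≡ j
    C-distinct i j = Q-distinct i j ∘ samePartition⇒sameQuartet (isC i) (isC j)

    C-incompatible : ¬ CharactersCompatible C ⊤
    C-incompatible (T , convex) =
      Q-incompatible (T , λ i i∈S → from (displays⇔convex T (isC i)) (convex i i∈S))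

    C-minimal : ∀ S → Proper S → CharactersCompatible C S
    C-minimal S S-proper with Q-minimal S S-proper
    ... | T , displays = T , λ i i∈S → to (displays⇔convex T (isC i)) (displays i i∈S)
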